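{- Let $\ell\ge1$ and let $X$ be a finite connected graph. Let $Y$ be a graph consisting of a complete graph $K_\ell$ with vertices numbered $1,\dots,\ell$ and $\ell$ disjoint isomorphic copies of $X$, such that for each $1\le i\le\ell$ some vertex of the $i$-th copy of $X$ is joined by an edge to the $i$-th vertex of $K_\ell$. Then $\chi_{um}(Y)\ge \ell-1+\chi_{um}(X)$.
   Context: A path is a simple path (a single vertex counts). A unique-maximum coloring of a graph with $k$ colors is a map from its vertices to $\{1,\dots,k\}$ such that on every path the maximum color occurs exactly once; $\chi_{um}$ is the minimum such $k$. -}

module Defs where

open import Data.Nat using (ℕ; zero; suc; _⊔_; _≤_; _≟_)
open import Data.Fin using (Fin; toℕ)
open import Data.List using (List; []; _∷_; map; foldr; filter; length)
open import Data.List.Relation.Unary.Unique.Propositional using (Unique)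
open import Data.Product using (_×_; _,_; Σ)
open import Data.Sum using (_⊎_; inj₁; inj₂)
open import Data.Empty using (⊥)
open import Relation.Nullary using (¬_)
open import Relation.Binary.PropositionalEquality using (_≡_; _≢_; refl; sym)

record SimpleGraph (V : Set) : Set₁ where
  field
    Adj    : V → V → Set
    adj-sym : ∀ {u v} → Adj u v → Adj v u
    adj-irrefl : ∀ {v} → ¬ Adj v v
open SimpleGraph public

module _ {V : Set} (G : SimpleGraph V) where

  data IsWalk : List V → Set where
    single : ∀ v → IsWalk (v ∷ [])
    cons   : ∀ {u v vs} → Adj G u v → IsWalk (v ∷ vs) → IsWalk (u ∷ v ∷ vs)

  IsPath : List V → Set
  IsPath p = IsWalk p × Unique p

  data Reach : V → V → Set where
    here : ∀ {v} → Reach v v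
    step : ∀ {u w v} → Adj G u w → Reach w v → Reach u v

  Connected : Set
  Connected = ∀ u v → Reach u v

  maxColour : ∀ {k} → (V → Fin k) → List V → ℕ
  maxColour c p = foldr _⊔_ 0 (map (λ v → toℕ (c v)) p)

  countColour : ∀ {k} → (V → Fin k) → ℕ → List V → ℕ
  countColour c m p = length (filter (λ v → toℕ (c v) ≟ m) p)

  -- unique-maximum colouring with k colours (colours Fin k ≅ {1..k})
  IsUMColouring : ∀ k → (V → Fin k) → Set
  IsUMColouring k c = ∀ p → IsPath p → countColour c (maxColour c p) p ≡ 1

  UMColourable : ℕ → Set
  UMColourable k = Σ (V → Fin k) (IsUMColouring k)

  IsChiUM : ℕ → Set
  IsChiUM m = UMColourable m × (∀ k → UMColourable k → m ≤ k)

-- The graph Y: K_ℓ on vertices inj₁ i, plus ℓ copies of X (vertices inj₂ (i , x)),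
-- with vertex (a i) of the i-th copy joined to vertex i of K_ℓ.
module _ (ℓ n : ℕ) (X : SimpleGraph (Fin n)) (a : Fin ℓ → Fin n) where

  YV : Set
  YV = Fin ℓ ⊎ (Fin ℓ × Fin n)

  data YAdj : YV → YV → Set where
    kk   : ∀ {i j} → i ≢ j → YAdj (inj₁ i) (inj₁ j)
    xx   : ∀ {i u v} → Adj X u v → YAdj (inj₂ (i , u)) (inj₂ (i , v))
    kx   : ∀ {i} → YAdj (inj₁ i) (inj₂ (i , a i))
    xk   : ∀ {i} → YAdj (inj₂ (i , a i)) (inj₁ i)

  YAdj-sym : ∀ {u v} → YAdj u v → YAdj v u
  YAdj-sym (kk p) = kk (λ e → p (sym e))
  YAdj-sym (xx e) = xx (adj-sym X e)
  YAdj-sym kx = xk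
  YAdj-sym xk = kx

  YAdj-irrefl : ∀ {v} → ¬ YAdj v v
  YAdj-irrefl (kk p) = p refl
  YAdj-irrefl (xx e) = adj-irrefl X e

  Ygraph : SimpleGraph YV
  Ygraph = record { Adj = YAdj ; adj-sym = YAdj-sym ; adj-irrefl = YAdj-irrefl }

-- Colour Y by a unique-maximum colouring c with k colours, and call a branch the hub vertex i of
-- K_ℓ together with the i-th copy of X.  Two distinct branches are joined by paths running
-- through their hubs, so if the maxima of c on two branches were equal, a path through both
-- maximising vertices would carry its maximum twice.  Hence the ℓ branch maxima are distinct
-- colours below k; the smallest of them, M, leaves room for ℓ - 1 larger ones, so M + ℓ ≤ k.
-- Restricted to the copy of X in the branch attaining M, c is a unique-maximum colouring with
-- all colours below k - (ℓ - 1), which gives χ_um(X) ≤ χ_um(Y) - (ℓ - 1).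
module Submission where

open import Defs
open import Data.Nat using (ℕ; suc; _⊔_; _≤_; _<_; _≟_; _∸_; _+_; z≤n; s≤s)
open import Data.Nat.Properties
open import Data.Fin using (Fin; toℕ; fromℕ<) renaming (zero to fzero)
open import Data.Fin.Properties using (toℕ<n; toℕ-fromℕ<; injective⇒≤) renaming (_≟_ to _≟ᶠ_)
open import Data.List using (List; []; _∷_; map; foldr; filter; length; _++_; allFin)
open import Data.List.Properties using (map-cong; map-∘; filter-≐; filter-++; filter-accept; filter-reject; length-++)
open import Data.List.Extrema ≤-totalOrder using (argmax; argmin; argmax-all; f[⊥]≤f[argmax]; f[xs]≤f[argmax]; f[argmin]≤f[xs])
open import Data.List.Membership.Propositional using (_∈_)
open import Data.List.Membership.Propositional.Properties using (∈-map⁺; ∈-allFin; ∈-filter⁺; ∈-++⁺ˡ)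
open import Data.List.Relation.Unary.All as All using (All; []; _∷_)
open import Data.List.Relation.Unary.All.Properties as All using ()
open import Data.List.Relation.Unary.Any using (here; there)
open import Data.List.Relation.Unary.AllPairs using ([]; _∷_)
open import Data.List.Relation.Unary.Unique.Propositional using (Unique)
import Data.List.Relation.Unary.Unique.Propositional.Properties as Unique
open import Data.Product using (_,_; proj₁; proj₂; ∃-syntax)
open import Data.Sum using (_⊎_; inj₁; inj₂)
open import Data.Empty using (⊥-elim)
open import Function using (_∘_; Injective)
open import Relation.Nullary using (yes; no)
open import Relation.Binary.Definitions using (DecidableEquality)
open import Relation.Binary.PropositionalEquality using (_≡_; _≢_; refl; sym; trans; cong; subst; _≗_)

module _ {V : Set} where

  maxOf : (V → ℕ) → List V → ℕ
  maxOf f p = foldr _⊔_ 0 (map f p)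

  countOf : (V → ℕ) → ℕ → List V → ℕ
  countOf f m p = length (filter (λ v → f v ≟ m) p)

  -- IsUMColouring G k c unfolds to IsUniqueMax G (toℕ ∘ c).
  IsUniqueMax : SimpleGraph V → (V → ℕ) → Set
  IsUniqueMax G f = ∀ p → IsPath G p → countOf f (maxOf f p) p ≡ 1

  maxOf-≤ : ∀ {f T} p → All (λ v → f v ≤ T) p → maxOf f p ≤ T
  maxOf-≤ []      []             = z≤n
  maxOf-≤ (_ ∷ p) (fv≤T ∷ p≤T) = ⊔-lub fv≤T (maxOf-≤ p p≤T)

  ≤-maxOf : ∀ {f v} p → v ∈ p → f v ≤ maxOf f p
  ≤-maxOf {f} (w ∷ p) (here refl) = m≤m⊔n (f w) (maxOf f p)
  ≤-maxOf {f} (w ∷ p) (there v∈p) = ≤-trans (≤-maxOf p v∈p) (m≤n⊔m (f w) (maxOf f p))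

  countOf-++ : ∀ f m xs ys → countOf f m (xs ++ ys) ≡ countOf f m xs + countOf f m ys
  countOf-++ f m xs ys = trans (cong length (filter-++ _ xs ys)) (length-++ (filter _ xs))

  countOf-pos : ∀ {f v} p → v ∈ p → 1 ≤ countOf f (f v) p
  countOf-pos {f} {v} p v∈p = nonempty (∈-filter⁺ (λ w → f w ≟ f v) v∈p refl)
    where
    nonempty : ∀ {xs : List V} → v ∈ xs → 1 ≤ length xs
    nonempty {_ ∷ _} _ = s≤s z≤n

  IsUniqueMax-cong : ∀ {G f g} → f ≗ g → IsUniqueMax G f → IsUniqueMax G g
  IsUniqueMax-cong {f = f} {g} f≗g f-um p path =
    subst (_≡ 1) count≡ (subst (λ m → countOf f m p ≡ 1) max≡ (f-um p path))
    where
    max≡ : maxOf f p ≡ maxOf g p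
    max≡ = cong (foldr _⊔_ 0) (map-cong f≗g p)
    count≡ : countOf f (maxOf g p) p ≡ countOf g (maxOf g p) p
    count≡ = cong length (filter-≐ _ _ ((λ {v} → trans (sym (f≗g v))) , (λ {v} → trans (f≗g v))) p)

  module _ {G : SimpleGraph V} {f : V → ℕ} (f-um : IsUniqueMax G f) where

    maximum-not-repeated : ∀ {xs ys u v} → IsPath G (xs ++ ys) → All (λ w → f w ≤ f u) (xs ++ ys) →
                           u ∈ xs → v ∈ ys → f u ≢ f v
    maximum-not-repeated {xs} {ys} {u} {v} path bounded u∈xs v∈ys fu≡fv =
      <-irrefl refl (≤-trans two≤count (≤-reflexive count≡1))
      where
      max≡ : maxOf f (xs ++ ys) ≡ f u
      max≡ = ≤-antisym (maxOf-≤ (xs ++ ys) bounded) (≤-maxOf (xs ++ ys) (∈-++⁺ˡ u∈xs))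
      count≡1 : countOf f (f u) (xs ++ ys) ≡ 1
      count≡1 = subst (λ m → countOf f m (xs ++ ys) ≡ 1) max≡ (f-um _ path)
      two≤count : 2 ≤ countOf f (f u) (xs ++ ys)
      two≤count = subst (2 ≤_) (sym (countOf-++ f (f u) xs ys))
        (+-mono-≤ (countOf-pos xs u∈xs) (subst (λ m → 1 ≤ countOf f m ys) (sym fu≡fv) (countOf-pos ys v∈ys)))

  walk-++ : ∀ (G : SimpleGraph V) {xs u w ys} → IsWalk G (xs ++ u ∷ []) → Adj G u w → IsWalk G (w ∷ ys) →
            IsWalk G ((xs ++ u ∷ []) ++ w ∷ ys)
  walk-++ G {xs = []}              (single _)      u~w walk = cons u~w walk
  walk-++ G {xs = _ ∷ []}          (cons x~u _)    u~w walk = cons x~u (cons u~w walk)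
  walk-++ G {xs = _ ∷ xs@(_ ∷ _)} (cons x~y rest) u~w walk = cons x~y (walk-++ G {xs} rest u~w walk)

  lastOf : V → List V → V
  lastOf u []       = u
  lastOf u (v ∷ vs) = lastOf v vs

  lastOf-∈ : ∀ u vs → lastOf u vs ∈ u ∷ vs
  lastOf-∈ u []       = here refl
  lastOf-∈ u (v ∷ vs) = there (lastOf-∈ v vs)

module _ {V W : Set} {G : SimpleGraph V} {H : SimpleGraph W} (e : V → W)
         (e-hom : ∀ {u v} → Adj G u v → Adj H (e u) (e v)) (e-injective : ∀ {u v} → e u ≡ e v → u ≡ v) where

  IsWalk-map : ∀ {p} → IsWalk G p → IsWalk H (map e p)
  IsWalk-map (single v)      = single (e v)
  IsWalk-map (cons u~v walk) = cons (e-hom u~v) (IsWalk-map walk)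

  countOf-map : ∀ f m p → countOf (f ∘ e) m p ≡ countOf f m (map e p)
  countOf-map f m []      = refl
  countOf-map f m (v ∷ p) with f (e v) ≟ m
  ... | yes fev≡m = trans (cong length (filter-accept (λ w → f (e w) ≟ m) fev≡m))
                      (trans (cong suc (countOf-map f m p)) (sym (cong length (filter-accept (λ w → f w ≟ m) fev≡m))))
  ... | no fev≢m  = trans (cong length (filter-reject (λ w → f (e w) ≟ m) fev≢m))
                      (trans (countOf-map f m p) (sym (cong length (filter-reject (λ w → f w ≟ m) fev≢m))))

  IsUniqueMax-comap : ∀ {f} → IsUniqueMax H f → IsUniqueMax G (f ∘ e)
  IsUniqueMax-comap {f} f-um p (walk , uniq) =
    trans (cong (λ m → countOf (f ∘ e) m p) (cong (foldr _⊔_ 0) (map-∘ p)))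
          (trans (countOf-map f _ p) (f-um (map e p) (IsWalk-map walk , Unique.map⁺ e-injective uniq)))

module _ {V : Set} (G : SimpleGraph V) (_≟ᵥ_ : DecidableEquality V) where

  record PathFromTo (u v : V) : Set where
    constructor pathFromTo
    field
      tail   : List V
      isPath : IsPath G (u ∷ tail)
      ends   : lastOf u tail ≡ v

  suffixFrom : ∀ u {w q} → IsPath G (w ∷ q) → All (u ≢_) (w ∷ q) ⊎ PathFromTo u (lastOf w q)
  suffixFrom u {w} {q} path with u ≟ᵥ w
  suffixFrom u {q = q}     path                       | yes refl = inj₂ (pathFromTo q path refl)
  suffixFrom u {q = []}    _                          | no u≢w  = inj₁ (u≢w ∷ [])
  suffixFrom u {q = _ ∷ _} (cons _ walk , _ ∷ uniq) | no u≢w  with suffixFrom u (walk , uniq)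
  ... | inj₁ u∉ = inj₁ (u≢w ∷ u∉)
  ... | inj₂ p  = inj₂ p

  -- A walk is shortened to a path by cutting it at the last visit of its starting vertex.
  reach⇒path : ∀ {u v} → Reach G u v → PathFromTo u v
  reach⇒path {u} here = pathFromTo [] (single u , [] ∷ []) refl
  reach⇒path {u} (step {w = w} u~w reach) with reach⇒path reach
  ... | pathFromTo q path@(walk , uniq) ends with suffixFrom u path
  ...   | inj₁ u∉ = pathFromTo (w ∷ q) (cons u~w walk , u∉ ∷ uniq) ends
  ...   | inj₂ (pathFromTo s path′ ends′) = pathFromTo s path′ (trans ends′ ends)

injective⇒∃-room : ∀ {m k} (M : Fin (suc m) → ℕ) → Injective _≡_ _≡_ M → (∀ i → M i < k) →
                   ∃[ i ] M i + suc m ≤ k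
injective⇒∃-room {m} {k} M M-injective M<k =
  i₀ , ≤-trans (≤-reflexive (+-comm (M i₀) (suc m))) (m≤o∸n⇒m+n≤o (suc m) (<⇒≤ (M<k i₀)) (injective⇒≤ shifted-injective))
  where
  i₀ : Fin (suc m)
  i₀ = argmin M fzero (allFin (suc m))
  minimal : ∀ j → M i₀ ≤ M j
  minimal j = All.lookup (f[argmin]≤f[xs] {f = M} fzero (allFin (suc m))) (∈-allFin j)
  shifted : Fin (suc m) → Fin (k ∸ M i₀)
  shifted j = fromℕ< (∸-monoˡ-< (M<k j) (minimal j))
  shifted-injective : Injective _≡_ _≡_ shifted
  shifted-injective {i} {j} shifted≡ = M-injective (∸-cancelʳ-≡ (minimal i) (minimal j)
    (trans (sym (toℕ-fromℕ< _)) (trans (cong toℕ shifted≡) (toℕ-fromℕ< _))))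

module Branches (ℓ n : ℕ) (X : SimpleGraph (Fin n)) (a : Fin ℓ → Fin n) (X-connected : Connected X) where

  private
    Y = Ygraph ℓ n X a
    V = YV ℓ n X a

  hub : Fin ℓ → V
  hub = inj₁

  copy : Fin ℓ → Fin n → V
  copy i x = inj₂ (i , x)

  branch : V → Fin ℓ
  branch (inj₁ i)       = i
  branch (inj₂ (i , _)) = i

  copy-injective : ∀ {i x y} → copy i x ≡ copy i y → x ≡ y
  copy-injective refl = refl

  copies-in-branch : ∀ {i} xs → All (λ w → branch w ≡ i) (map (copy i) xs)
  copies-in-branch xs = All.map⁺ (All.universal (λ _ → refl) xs)

  hub∉copies : ∀ {i j} xs → All (hub j ≢_) (map (copy i) xs)
  hub∉copies xs = All.map⁺ (All.universal (λ _ ()) xs)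

  walk-to-hub : ∀ {i x s} → IsWalk X (x ∷ s) → lastOf x s ≡ a i → IsWalk Y (map (copy i) (x ∷ s) ++ hub i ∷ [])
  walk-to-hub {s = []}    (single _)      refl = cons xk (single _)
  walk-to-hub {s = _ ∷ _} (cons x~y walk) ends = cons (xx x~y) (walk-to-hub walk ends)

  record ArmTo (v : V) : Set where
    field
      before   : List V
      isPath   : IsPath Y (before ++ hub (branch v) ∷ [])
      inBranch : All (λ w → branch w ≡ branch v) (before ++ hub (branch v) ∷ [])
      visits   : v ∈ before ++ hub (branch v) ∷ []

  record ArmFrom (v : V) : Set where
    field
      after    : List V
      isPath   : IsPath Y (hub (branch v) ∷ after)
      inBranch : All (λ w → branch w ≡ branch v) (hub (branch v) ∷ after)
      visits   : v ∈ hub (branch v) ∷ after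

  armTo : ∀ v → ArmTo v
  armTo (inj₁ i) = record { before = [] ; isPath = single _ , [] ∷ [] ; inBranch = refl ∷ [] ; visits = here refl }
  armTo (inj₂ (i , x)) with reach⇒path X _≟ᶠ_ (X-connected x (a i))
  ... | pathFromTo s (walk , uniq) ends = record
    { before   = map (copy i) (x ∷ s)
    ; isPath   = walk-to-hub walk ends ,
                 Unique.++⁺ (Unique.map⁺ copy-injective uniq) ([] ∷ [])
                   (λ { (h∈ , here refl) → All.lookup (hub∉copies (x ∷ s)) h∈ refl })
    ; inBranch = All.++⁺ (copies-in-branch (x ∷ s)) (refl ∷ [])
    ; visits   = here refl
    }

  armFrom : ∀ v → ArmFrom v
  armFrom (inj₁ i) = record { after = [] ; isPath = single _ , [] ∷ [] ; inBranch = refl ∷ [] ; visits = here refl }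
  armFrom (inj₂ (i , y)) with reach⇒path X _≟ᶠ_ (X-connected (a i) y)
  ... | pathFromTo s (walk , uniq) ends = record
    { after    = map (copy i) (a i ∷ s)
    ; isPath   = cons kx (IsWalk-map (copy i) xx copy-injective walk) ,
                 hub∉copies (a i ∷ s) ∷ Unique.map⁺ copy-injective uniq
    ; inBranch = refl ∷ copies-in-branch (a i ∷ s)
    ; visits   = there (subst (_∈ map (copy i) (a i ∷ s)) (cong (copy i) ends) (∈-map⁺ (copy i) (lastOf-∈ (a i) s)))
    }

  module _ {f : V → ℕ} (f-um : IsUniqueMax Y f) where

    branch-maxima-distinct : ∀ {u v} → branch u ≢ branch v →
                             (∀ w → branch w ≡ branch u → f w ≤ f u) →
                             (∀ w → branch w ≡ branch v → f w ≤ f v) → f u ≢ f v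
    branch-maxima-distinct {u} {v} u≁v u-max v-max fu≡fv =
      maximum-not-repeated f-um path bounded u-visited v-visited fu≡fv
      where
      open ArmTo (armTo u) renaming (isPath to to-path; inBranch to to-branch; visits to u-visited)
      open ArmFrom (armFrom v) renaming (isPath to from-path; inBranch to from-branch; visits to v-visited)
      path : IsPath Y ((before ++ hub (branch u) ∷ []) ++ hub (branch v) ∷ after)
      path = walk-++ Y (to-path .proj₁) (kk u≁v) (from-path .proj₁) ,
             Unique.++⁺ (to-path .proj₂) (from-path .proj₂)
               (λ (w∈to , w∈from) → u≁v (trans (sym (All.lookup to-branch w∈to)) (All.lookup from-branch w∈from)))
      bounded : All (λ w → f w ≤ f u) ((before ++ hub (branch u) ∷ []) ++ hub (branch v) ∷ after)
      bounded = All.++⁺ (All.map (u-max _) to-branch)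
                        (All.map (λ bw≡bv → ≤-trans (v-max _ bw≡bv) (≤-reflexive (sym fu≡fv))) from-branch)

    peak : Fin ℓ → V
    peak i = argmax f (hub i) (map (copy i) (allFin n))

    branch-peak : ∀ i → branch (peak i) ≡ i
    branch-peak i = argmax-all f refl (copies-in-branch (allFin n))

    peak-maximal : ∀ {i} w → branch w ≡ i → f w ≤ f (peak i)
    peak-maximal (inj₁ i)       refl = f[⊥]≤f[argmax] {f = f} (hub i) (map (copy i) (allFin n))
    peak-maximal (inj₂ (i , x)) refl =
      All.lookup (f[xs]≤f[argmax] {f = f} (hub i) (map (copy i) (allFin n))) (∈-map⁺ (copy i) (∈-allFin x))

    peak-colours-injective : Injective _≡_ _≡_ (f ∘ peak)
    peak-colours-injective {i} {j} fpi≡fpj with i ≟ᶠ j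
    ... | yes i≡j = i≡j
    ... | no  i≢j = ⊥-elim (branch-maxima-distinct
      (λ bi≡bj → i≢j (trans (sym (branch-peak i)) (trans bi≡bj (branch-peak j))))
      (λ w bw≡ → peak-maximal w (trans bw≡ (branch-peak i)))
      (λ w bw≡ → peak-maximal w (trans bw≡ (branch-peak j)))
      fpi≡fpj)

  module _ {k} {c : V → Fin k} (c-um : IsUMColouring Y k c) where

    copy-colourable : ∀ {i s} → toℕ (c (peak c-um i)) + suc s ≤ k → UMColourable X (k ∸ s)
    copy-colourable {i} {s} room = restricted , restricted-um
      where
      copy-colour< : ∀ x → toℕ (c (copy i x)) < k ∸ s
      copy-colour< x = m+n≤o⇒m≤o∸n (suc (toℕ (c (copy i x))))
        (≤-trans (≤-reflexive (sym (+-suc _ s))) (≤-trans (+-monoˡ-≤ (suc s) (peak-maximal c-um (copy i x) refl)) room))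
      restricted : Fin n → Fin (k ∸ s)
      restricted x = fromℕ< (copy-colour< x)
      restricted-um : IsUMColouring X (k ∸ s) restricted
      restricted-um = IsUniqueMax-cong (λ x → sym (toℕ-fromℕ< (copy-colour< x)))
                        (IsUniqueMax-comap (copy i) xx copy-injective c-um)

lemma4 : (ℓ n : ℕ) → 1 ≤ ℓ → (X : SimpleGraph (Fin n)) → Connected X →
           (a : Fin ℓ → Fin n) → (χX χY : ℕ) →
           IsChiUM X χX → IsChiUM (Ygraph ℓ n X a) χY →
           ℓ ∸ 1 + χX ≤ χY
lemma4 (suc m) n _ X X-connected a χX χY (_ , χX-minimal) ((c , c-um) , _) =
  let open Branches (suc m) n X a X-connected
      (_ , room) = injective⇒∃-room (toℕ ∘ c ∘ peak c-um) (peak-colours-injective c-um)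
                                    (λ i → toℕ<n (c (peak c-um i)))
      m≤χY = ≤-trans (n≤1+n m) (m+n≤o⇒n≤o _ room)
      χX≤χY∸m = χX-minimal (χY ∸ m) (copy-colourable c-um room)
  in ≤-trans (≤-reflexive (+-comm m χX)) (m≤o∸n⇒m+n≤o χX m≤χY χX≤χY∸m)
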